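{- Let $G$ be a graph of order $n$ with maximum degree $\Delta$, and let $k$ be the number of edges $v_iv_j\in E(G)$ with $d_i=d_j$. Then $$ISDD(G)\leq \frac{k}{2}+\frac{\Delta(\Delta-1)}{\Delta^2+(\Delta-1)^2}\left(\frac{n\Delta}{2}-k\right).$$ Moreover, if $G$ is connected, equality holds if and only if $G$ is a regular graph.
   Context: For a simple graph $G$ with vertex degrees $d_i$, $ISDD(G)=\sum_{v_iv_j\in E(G)}\frac{d_id_j}{d_i^2+d_j^2}$. -}

module Defs where

open import Data.Bool using (Bool; true; false; if_then_else_; _∧_)
open import Data.Nat as ℕ using (ℕ; zero; suc; _*_; _+_; _∸_; _⊔_; _≡ᵇ_; _<ᵇ_)
open import Data.Fin using (Fin; toℕ)
open import Data.List using (List; map; foldr; allFin)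
open import Data.Nat.ListAction using (sum)
open import Data.Integer using (+_)
open import Data.Rational as ℚ using (ℚ; 0ℚ)
open import Relation.Binary.PropositionalEquality using (_≡_)
open import Data.Product using (∃)

record Graph (n : ℕ) : Set where
  field
    adj    : Fin n → Fin n → Bool
    sym    : ∀ i j → adj i j ≡ adj j i
    irrefl : ∀ i → adj i i ≡ false
open Graph public

deg : ∀ {n} → Graph n → Fin n → ℕ
deg G i = sum (map (λ j → if adj G i j then 1 else 0) (allFin _))

-- maximum degree Δ (0 for the empty vertex set)
maxDeg : ∀ {n} → Graph n → ℕ
maxDeg G = foldr _⊔_ 0 (map (deg G) (allFin _))

sumℚ : List ℚ → ℚ
sumℚ = foldr ℚ._+_ 0ℚ

-- p / q as a rational (only used with q ≠ 0; q = 0 gives 0)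
frac : ℕ → ℕ → ℚ
frac p zero    = 0ℚ
frac p (suc q) = (+ p) ℚ./ suc q

-- sum over the edges v_i v_j (each unordered edge once, via i < j)
sumEdges : ∀ {n} → Graph n → (Fin n → Fin n → ℚ) → ℚ
sumEdges {n} G f =
  sumℚ (map (λ i → sumℚ (map (λ j →
    if (toℕ i <ᵇ toℕ j) ∧ adj G i j then f i j else 0ℚ) (allFin n))) (allFin n))

ISDD : ∀ {n} → Graph n → ℚ
ISDD G = sumEdges G (λ i j → frac (deg G i * deg G j)
                                  (deg G i * deg G i + deg G j * deg G j))

kEq : ∀ {n} → Graph n → ℕ
kEq {n} G = sum (map (λ i → sum (map (λ j →
    if (toℕ i <ᵇ toℕ j) ∧ adj G i j ∧ (deg G i ≡ᵇ deg G j) then 1 else 0)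
    (allFin n))) (allFin n))

data Reachable {n} (G : Graph n) : Fin n → Fin n → Set where
  here : ∀ {i} → Reachable G i i
  step : ∀ {i j l} → adj G i j ≡ true → Reachable G j l → Reachable G i l

Connected : ∀ {n} → Graph n → Set
Connected G = ∀ i j → Reachable G i j

Regular : ∀ {n} → Graph n → Set
Regular G = ∃ λ r → ∀ i → deg G i ≡ r

-- right-hand side  k/2 + Δ(Δ-1)/(Δ²+(Δ-1)²) · (nΔ/2 - k)
-- (for Δ ≥ 1, ℕ-subtraction Δ ∸ 1 is exact; for Δ = 0 the coefficient is 0 either way)
bound : ∀ {n} → Graph n → ℚ
bound {n} G =
  ((+ kEq G) ℚ./ 2)
  ℚ.+ frac (Δ * (Δ ∸ 1)) (Δ * Δ + (Δ ∸ 1) * (Δ ∸ 1))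
      ℚ.* (((+ (n * Δ)) ℚ./ 2) ℚ.- ((+ kEq G) ℚ./ 1))
  where Δ = maxDeg G

-- An edge whose ends have equal degree contributes exactly 1/2. If the degrees a ≠ b lie in
-- [1, Δ], then ab/(a² + b²) ≤ c := Δ(Δ−1)/(Δ² + (Δ−1)²), since with Q = Δ, P = Δ − 1,
--   QP(a² + b²) − ab(Q² + P²) = (bP − aQ)(bQ − aP),
-- and for a < b ≤ Q both factors are nonnegative. Hence ISDD ≤ k/2 + c(m − k), where m is the
-- number of edges; by the handshake lemma 2m = Σ dᵢ ≤ nΔ, so the claimed bound exceeds this by
-- c(nΔ − Σ dᵢ)/2 ≥ 0. For Δ ≥ 2 we have c > 0, so equality forces Σ dᵢ = nΔ, i.e. regularity;
-- for Δ ≤ 1 a connected graph is regular anyway. Conversely, in a regular graph every edge has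
-- equal end degrees and Σ dᵢ = nΔ, so both inequalities are equalities.
module Submission where

open import Defs hiding (sym)

open import Data.Bool using (Bool; true; false; if_then_else_; _∧_; T)
open import Data.Bool.Properties using (∧-assoc; ∧-conicalʳ; T-≡)
open import Data.Empty using (⊥-elim)
open import Data.Fin using (Fin; toℕ; zero)
open import Data.Fin.Properties using (toℕ-injective)
open import Data.Integer as ℤ using (+_)
import Data.Integer.Properties as ℤP
open import Data.Integer.Solver using () renaming (module +-*-Solver to ℤ-Solver)
open import Data.List using ([]; _∷_; map; foldr; allFin; length)
open import Data.List.Membership.Propositional using (_∈_)
open import Data.List.Membership.Propositional.Properties using (∈-allFin; ∈-map⁺)
open import Data.List.Properties using (map-cong; length-tabulate)
open import Data.List.Relation.Unary.Any using (here; there)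
open import Data.Nat as ℕ using (ℕ; zero; suc; _+_; _*_; _∸_; _⊔_; _≡ᵇ_; _<ᵇ_; z≤n)
open import Data.Nat.ListAction using (sum)
import Data.Nat.Properties as ℕP
open import Algebra.Properties.CommutativeSemigroup ℕP.+-commutativeSemigroup
  using () renaming (interchange to +-interchange)
open import Data.Nat.Solver using () renaming (module +-*-Solver to ℕ-Solver)
open import Data.Product using (_×_; _,_)
open import Data.Rational as ℚ using (ℚ; 0ℚ; ½; _≤_; _<_)
import Data.Rational.Properties as ℚP
open import Data.Rational.Solver using () renaming (module +-*-Solver to ℚ-Solver)
open import Data.Rational.Unnormalised as ℚᵘ using (mkℚᵘ; *≡*; *≤*)
import Data.Rational.Unnormalised.Properties as ℚᵘP
open import Data.Sum using (_⊎_; inj₁; inj₂)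
open import Function.Bundles using (_⇔_; mk⇔; Equivalence)
open import Relation.Binary.Definitions using (tri<; tri≈; tri>)
open import Relation.Binary.PropositionalEquality
open import Relation.Nullary.Decidable using (yes; no)
open import Relation.Nullary.Reflects using (ofʸ; ofⁿ)

fromℕ : ℕ → ℚ
fromℕ a = frac a 1

toℚᵘ-frac : ∀ a b → ℚ.toℚᵘ (frac a (suc b)) ℚᵘ.≃ mkℚᵘ (+ a) b
toℚᵘ-frac a b = ℚP.toℚᵘ-fromℚᵘ (mkℚᵘ (+ a) b)

frac-≤ : ∀ {a b c d} → a * suc d ℕ.≤ c * suc b → frac a (suc b) ≤ frac c (suc d)
frac-≤ {a} {b} {c} {d} cross = ℚP.toℚᵘ-cancel-≤
  (ℚᵘP.≤-respˡ-≃ (ℚᵘP.≃-sym (toℚᵘ-frac a b)) (ℚᵘP.≤-respʳ-≃ (ℚᵘP.≃-sym (toℚᵘ-frac c d))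
    (*≤* (subst₂ ℤ._≤_ (ℤP.pos-* a (suc d)) (ℤP.pos-* c (suc b)) (ℤ.+≤+ cross)))))

fromℕ-+ : ∀ a b → fromℕ (a + b) ≡ fromℕ a ℚ.+ fromℕ b
fromℕ-+ a b = ℚP.toℚᵘ-injective
  (ℚᵘP.≃-trans (toℚᵘ-frac (a + b) 0) (ℚᵘP.≃-trans (*≡* cross)
    (ℚᵘP.≃-trans (ℚᵘP.+-cong (ℚᵘP.≃-sym (toℚᵘ-frac a 0)) (ℚᵘP.≃-sym (toℚᵘ-frac b 0)))
      (ℚᵘP.≃-sym (ℚP.toℚᵘ-homo-+ (fromℕ a) (fromℕ b))))))
  where
  open ℤ-Solver
  cross : (+ a ℤ.+ + b) ℤ.* + 1 ≡ (+ a ℤ.* + 1 ℤ.+ + b ℤ.* + 1) ℤ.* + 1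
  cross = solve 2 (λ x y → (x :+ y) :* con (+ 1) := (x :* con (+ 1) :+ y :* con (+ 1)) :* con (+ 1))
    refl (+ a) (+ b)

/2≡½*fromℕ : ∀ a → (+ a) ℚ./ 2 ≡ ½ ℚ.* fromℕ a
/2≡½*fromℕ a = ℚP.toℚᵘ-injective
  (ℚᵘP.≃-trans (toℚᵘ-frac a 1) (ℚᵘP.≃-trans (*≡* cross)
    (ℚᵘP.≃-trans (ℚᵘP.*-cong {mkℚᵘ (+ 1) 1} {ℚ.toℚᵘ ½} (*≡* refl) (ℚᵘP.≃-sym (toℚᵘ-frac a 0)))
      (ℚᵘP.≃-sym (ℚP.toℚᵘ-homo-* ½ (fromℕ a))))))
  where
  open ℤ-Solver
  cross : + a ℤ.* + 2 ≡ (+ 1 ℤ.* + a) ℤ.* + 2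
  cross = solve 1 (λ x → x :* con (+ 2) := (con (+ 1) :* x) :* con (+ 2)) refl (+ a)

fromℕ-nonNeg : ∀ a → ℚ.NonNegative (fromℕ a)
fromℕ-nonNeg a = ℚP.normalize-nonNeg a 1

fromℕ-pos : ∀ {a} → 0 ℕ.< a → ℚ.Positive (fromℕ a)
fromℕ-pos {suc a} _ = ℚP.normalize-pos (suc a) 1

isddWeight : ℕ → ℕ → ℚ
isddWeight a b = frac (a * b) (a * a + b * b)

isddWeight-diag : ∀ {a b} → 1 ℕ.≤ a → a ≡ b → isddWeight a b ≡ ½
isddWeight-diag {suc a} _ refl = ℚP.≤-antisym
  (frac-≤ {x * x} {c = 1} {1} (ℕP.≤-reflexive twice))
  (frac-≤ {1} {1} {x * x} (ℕP.≤-reflexive (sym twice)))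
  where
  open ℕ-Solver
  x = suc a
  twice : x * x * 2 ≡ 1 * (x * x + x * x)
  twice = solve 1 (λ y → y :* y :* con 2 := con 1 :* (y :* y :+ y :* y)) refl x

-- The factorisation above with u = B P − A Q and v = B Q − A P moved across, so that no
-- subtraction occurs.
cross-identity : ∀ A B P Q u v → B * P ≡ A * Q + u → B * Q ≡ A * P + v →
                 A * B * (Q * Q + P * P) + u * v ≡ Q * P * (A * A + B * B)
cross-identity A B P Q u v BP≡ BQ≡ = begin
  A * B * (Q * Q + P * P) + u * v
    ≡⟨ solve 6 (λ A B P Q u v → A :* B :* (Q :* Q :+ P :* P) :+ u :* v
                := A :* Q :* (B :* Q) :+ A :* P :* (B :* P) :+ u :* v) refl A B P Q u v ⟩
  A * Q * (B * Q) + A * P * (B * P) + u * v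
    ≡⟨ cong₂ (λ x y → A * Q * x + A * P * y + u * v) BQ≡ BP≡ ⟩
  A * Q * (A * P + v) + A * P * (A * Q + u) + u * v
    ≡⟨ solve 6 (λ A B P Q u v → A :* Q :* (A :* P :+ v) :+ A :* P :* (A :* Q :+ u) :+ u :* v
                := Q :* P :* (A :* A) :+ (A :* Q :+ u) :* (A :* P :+ v)) refl A B P Q u v ⟩
  Q * P * (A * A) + (A * Q + u) * (A * P + v)
    ≡⟨ cong₂ (λ x y → Q * P * (A * A) + x * y) (sym BP≡) (sym BQ≡) ⟩
  Q * P * (A * A) + B * P * (B * Q)
    ≡⟨ solve 4 (λ A B P Q → Q :* P :* (A :* A) :+ B :* P :* (B :* Q)
                := Q :* P :* (A :* A :+ B :* B)) refl A B P Q ⟩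
  Q * P * (A * A + B * B) ∎
  where
  open ≡-Reasoning
  open ℕ-Solver

cross-≤-< : ∀ {A B} P → A ℕ.< B → B ℕ.≤ suc P →
            A * B * (suc P * suc P + P * P) ℕ.≤ suc P * P * (A * A + B * B)
cross-≤-< {A} {B} P A<B B≤Q =
  subst (A * B * (Q * Q + P * P) ℕ.≤_) (cross-identity A B P Q _ _ (sym (ℕP.m+[n∸m]≡n AQ≤BP))
                                                            (sym (ℕP.m+[n∸m]≡n AP≤BQ)))
        (ℕP.m≤m+n _ _)
  where
  open ℕP.≤-Reasoning
  Q = suc P
  AQ≤BP : A * Q ℕ.≤ B * P
  AQ≤BP = ℕP.+-cancelʳ-≤ Q (A * Q) (B * P) (begin
    A * Q + Q ≡⟨ ℕP.+-comm (A * Q) Q ⟩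
    suc A * Q ≤⟨ ℕP.*-monoˡ-≤ Q A<B ⟩
    B * Q     ≡⟨ ℕP.*-suc B P ⟩
    B + B * P ≤⟨ ℕP.+-monoˡ-≤ (B * P) B≤Q ⟩
    Q + B * P ≡⟨ ℕP.+-comm Q (B * P) ⟩
    B * P + Q ∎)
  AP≤BQ : A * P ℕ.≤ B * Q
  AP≤BQ = ℕP.*-mono-≤ (ℕP.<⇒≤ A<B) (ℕP.n≤1+n P)

cross-≤ : ∀ {A B} P → A ≢ B → A ℕ.≤ suc P → B ℕ.≤ suc P →
          A * B * (suc P * suc P + P * P) ℕ.≤ suc P * P * (A * A + B * B)
cross-≤ {A} {B} P A≢B A≤Q B≤Q with ℕP.<-cmp A B
... | tri< A<B _ _ = cross-≤-< P A<B B≤Q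
... | tri≈ _ A≡B _ = ⊥-elim (A≢B A≡B)
... | tri> _ _ B<A = subst₂ ℕ._≤_ (cong (_* (suc P * suc P + P * P)) (ℕP.*-comm B A))
                                     (cong (suc P * P *_) (ℕP.+-comm (B * B) (A * A)))
                                     (cross-≤-< P B<A A≤Q)

isddWeight-≤-pred : ∀ {a b D} → a ≢ b → a ℕ.≤ D → b ℕ.≤ D → isddWeight a b ≤ isddWeight D (D ∸ 1)
isddWeight-≤-pred {zero}  {zero}          a≢b _   _   = ⊥-elim (a≢b refl)
isddWeight-≤-pred {suc a} {b}   {suc P}   a≢b a≤D b≤D =
  frac-≤ {suc a * b} {c = suc P * P} (cross-≤ P a≢b a≤D b≤D)
isddWeight-≤-pred {zero}  {suc b} {suc P} a≢b a≤D b≤D =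
  frac-≤ {0} {c = suc P * P} (cross-≤ P a≢b a≤D b≤D)
isddWeight-≤-pred {suc a} {_}     {zero}  _   ()  _
isddWeight-≤-pred {zero}  {suc b} {zero}  _   _   ()

isddWeight-≤-estimate : ∀ {a b D} → 1 ℕ.≤ a → a ℕ.≤ D → b ℕ.≤ D →
                        isddWeight a b ≤ (if a ≡ᵇ b then ½ else isddWeight D (D ∸ 1))
isddWeight-≤-estimate {a} {b} 1≤a a≤D b≤D with a ≡ᵇ b in a≡ᵇb
... | true  = ℚP.≤-reflexive (isddWeight-diag 1≤a (ℕP.≡ᵇ⇒≡ a b (subst T (sym a≡ᵇb) _)))
... | false = isddWeight-≤-pred (λ a≡b → subst T a≡ᵇb (ℕP.≡⇒≡ᵇ a b a≡b)) a≤D b≤D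

isddWeight-≡-estimate : ∀ {a b} D → 1 ℕ.≤ a → a ≡ b →
                        isddWeight a b ≡ (if a ≡ᵇ b then ½ else isddWeight D (D ∸ 1))
isddWeight-≡-estimate {a} {b} D 1≤a a≡b
  rewrite Equivalence.to T-≡ (ℕP.≡⇒≡ᵇ a b a≡b) = isddWeight-diag 1≤a a≡b

isddWeight-nonNeg : ∀ a b → ℚ.NonNegative (isddWeight a b)
isddWeight-nonNeg a b with a * a + b * b
... | zero  = _
... | suc q = ℚP.normalize-nonNeg (a * b) (suc q)

isddWeight-pred-pos : ∀ {D} → 2 ℕ.≤ D → ℚ.Positive (isddWeight D (D ∸ 1))
isddWeight-pred-pos {suc (suc P)} (ℕ.s≤s (ℕ.s≤s z≤n)) = ℚP.normalize-pos (suc (suc P) * suc P) _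

𝟙 : Bool → ℕ
𝟙 b = if b then 1 else 0

if-≤ : ∀ b {x y : ℚ} → (b ≡ true → x ≤ y) → (if b then x else 0ℚ) ≤ (if b then y else 0ℚ)
if-≤ true  x≤y = x≤y refl
if-≤ false _   = ℚP.≤-refl

if-≡ : ∀ b {x y : ℚ} → (b ≡ true → x ≡ y) → (if b then x else 0ℚ) ≡ (if b then y else 0ℚ)
if-≡ true  x≡y = x≡y refl
if-≡ false _   = refl

if-indicators : ∀ e q (c : ℚ) →
  (if e then (if q then ½ else c) else 0ℚ) ≡ c ℚ.* fromℕ (𝟙 e) ℚ.+ (½ ℚ.- c) ℚ.* fromℕ (𝟙 (e ∧ q))
if-indicators false q     c = solve 1 (λ c → con 0ℚ := c :* con 0ℚ :+ (con ½ :- c) :* con 0ℚ) refl c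
  where open ℚ-Solver
if-indicators true  true  c = solve 1 (λ c → con ½ := c :* con ℚ.1ℚ :+ (con ½ :- c) :* con ℚ.1ℚ) refl c
  where open ℚ-Solver
if-indicators true  false c = solve 1 (λ c → c := c :* con ℚ.1ℚ :+ (con ½ :- c) :* con 0ℚ) refl c
  where open ℚ-Solver

module _ {A : Set} where

  sumℚ-mono : ∀ {f g : A → ℚ} → (∀ x → f x ≤ g x) → ∀ xs → sumℚ (map f xs) ≤ sumℚ (map g xs)
  sumℚ-mono f≤g []       = ℚP.≤-refl
  sumℚ-mono f≤g (x ∷ xs) = ℚP.+-mono-≤ (f≤g x) (sumℚ-mono f≤g xs)

  sumℚ-linear : ∀ a b (f g : A → ℚ) xs →
    sumℚ (map (λ x → a ℚ.* f x ℚ.+ b ℚ.* g x) xs) ≡ a ℚ.* sumℚ (map f xs) ℚ.+ b ℚ.* sumℚ (map g xs)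
  sumℚ-linear a b f g [] = solve 2 (λ a b → con 0ℚ := a :* con 0ℚ :+ b :* con 0ℚ) refl a b
    where open ℚ-Solver
  sumℚ-linear a b f g (x ∷ xs) = trans (cong (a ℚ.* f x ℚ.+ b ℚ.* g x ℚ.+_) (sumℚ-linear a b f g xs))
    (solve 6 (λ a b fx gx F G → a :* fx :+ b :* gx :+ (a :* F :+ b :* G)
                                := a :* (fx :+ F) :+ b :* (gx :+ G))
       refl a b (f x) (g x) (sumℚ (map f xs)) (sumℚ (map g xs)))
    where open ℚ-Solver

  sumℚ-fromℕ : ∀ (f : A → ℕ) xs → sumℚ (map (λ x → fromℕ (f x)) xs) ≡ fromℕ (sum (map f xs))
  sumℚ-fromℕ f []       = refl
  sumℚ-fromℕ f (x ∷ xs) = trans (cong (fromℕ (f x) ℚ.+_) (sumℚ-fromℕ f xs)) (sym (fromℕ-+ (f x) _))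

  sum-+ : ∀ (f g : A → ℕ) xs → sum (map (λ x → f x + g x) xs) ≡ sum (map f xs) + sum (map g xs)
  sum-+ f g []       = refl
  sum-+ f g (x ∷ xs) = trans (cong (_+_ (f x + g x)) (sum-+ f g xs))
                             (+-interchange (f x) (g x) _ _)

  sum-map-const : ∀ {f : A → ℕ} {D} → (∀ x → f x ≡ D) → ∀ xs → sum (map f xs) ≡ length xs * D
  sum-map-const f≡D []       = refl
  sum-map-const f≡D (x ∷ xs) = cong₂ _+_ (f≡D x) (sum-map-const f≡D xs)

  sum-map-≤ : ∀ {f : A → ℕ} {D} → (∀ x → f x ℕ.≤ D) → ∀ xs → sum (map f xs) ℕ.≤ length xs * D
  sum-map-≤ f≤D []       = z≤n
  sum-map-≤ f≤D (x ∷ xs) = ℕP.+-mono-≤ (f≤D x) (sum-map-≤ f≤D xs)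

  sum-map-≡⇒≡ : ∀ {f : A → ℕ} {D} → (∀ x → f x ℕ.≤ D) → ∀ xs →
                sum (map f xs) ≡ length xs * D → ∀ {x} → x ∈ xs → f x ≡ D
  sum-map-≡⇒≡ {f} {D} f≤D (y ∷ ys) sum≡ (here refl) = ℕP.≤-antisym (f≤D y)
    (ℕP.+-cancelʳ-≤ (sum (map f ys)) D (f y)
      (ℕP.≤-trans (ℕP.+-monoʳ-≤ D (sum-map-≤ f≤D ys)) (ℕP.≤-reflexive (sym sum≡))))
  sum-map-≡⇒≡ {f} {D} f≤D (y ∷ ys) sum≡ (there x∈ys) = sum-map-≡⇒≡ f≤D ys
    (ℕP.≤-antisym (sum-map-≤ f≤D ys)
      (ℕP.+-cancelˡ-≤ D (length ys * D) (sum (map f ys))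
        (ℕP.≤-trans (ℕP.≤-reflexive (sym sum≡)) (ℕP.+-monoˡ-≤ _ (f≤D y)))))
    x∈ys

  ∈⇒≤sum : ∀ (f : A → ℕ) {x xs} → x ∈ xs → f x ℕ.≤ sum (map f xs)
  ∈⇒≤sum f (here refl)          = ℕP.m≤m+n _ _
  ∈⇒≤sum f {xs = y ∷ _} (there p) = ℕP.≤-trans (∈⇒≤sum f p) (ℕP.m≤n+m _ (f y))

  foldr-⊔-lub : ∀ {f : A → ℕ} {D} → (∀ x → f x ℕ.≤ D) → ∀ xs → foldr _⊔_ 0 (map f xs) ℕ.≤ D
  foldr-⊔-lub f≤D []       = z≤n
  foldr-⊔-lub f≤D (x ∷ xs) = ℕP.⊔-lub (f≤D x) (foldr-⊔-lub f≤D xs)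

∈⇒≤foldr-⊔ : ∀ {x : ℕ} {xs} → x ∈ xs → x ℕ.≤ foldr _⊔_ 0 xs
∈⇒≤foldr-⊔ (here refl)           = ℕP.m≤m⊔n _ _
∈⇒≤foldr-⊔ {xs = y ∷ _} (there p) = ℕP.≤-trans (∈⇒≤foldr-⊔ p) (ℕP.m≤n⊔m y _)

sum-transpose : ∀ {A B : Set} (h : A → B → ℕ) xs ys →
  sum (map (λ x → sum (map (h x) ys)) xs) ≡ sum (map (λ y → sum (map (λ x → h x y) xs)) ys)
sum-transpose h [] ys = sym (trans (sum-map-const (λ _ → refl) ys) (ℕP.*-zeroʳ (length ys)))
sum-transpose h (x ∷ xs) ys = trans (cong (_+_ (sum (map (h x) ys))) (sum-transpose h xs ys))
  (sym (sum-+ (h x) (λ y → sum (map (λ x → h x y) xs)) ys))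

sumℚ² : ∀ {n} → (Fin n → Fin n → ℚ) → ℚ
sumℚ² {n} f = sumℚ (map (λ i → sumℚ (map (f i) (allFin n))) (allFin n))

sum² : ∀ {n} → (Fin n → Fin n → ℕ) → ℕ
sum² {n} f = sum (map (λ i → sum (map (f i) (allFin n))) (allFin n))

module _ {n : ℕ} where

  sumℚ²-mono : ∀ {f g : Fin n → Fin n → ℚ} → (∀ i j → f i j ≤ g i j) → sumℚ² f ≤ sumℚ² g
  sumℚ²-mono f≤g = sumℚ-mono (λ i → sumℚ-mono (f≤g i) (allFin n)) (allFin n)

  sumℚ²-cong : ∀ {f g : Fin n → Fin n → ℚ} → (∀ i j → f i j ≡ g i j) → sumℚ² f ≡ sumℚ² g
  sumℚ²-cong f≡g = cong sumℚ (map-cong (λ i → cong sumℚ (map-cong (f≡g i) (allFin n))) (allFin n))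

  sumℚ²-linear : ∀ a b (f g : Fin n → Fin n → ℚ) →
    sumℚ² (λ i j → a ℚ.* f i j ℚ.+ b ℚ.* g i j) ≡ a ℚ.* sumℚ² f ℚ.+ b ℚ.* sumℚ² g
  sumℚ²-linear a b f g =
    trans (cong sumℚ (map-cong (λ i → sumℚ-linear a b (f i) (g i) (allFin n)) (allFin n)))
          (sumℚ-linear a b _ _ (allFin n))

  sumℚ²-fromℕ : ∀ (f : Fin n → Fin n → ℕ) → sumℚ² (λ i j → fromℕ (f i j)) ≡ fromℕ (sum² f)
  sumℚ²-fromℕ f = trans (cong sumℚ (map-cong (λ i → sumℚ-fromℕ (f i) (allFin n)) (allFin n)))
                        (sumℚ-fromℕ _ (allFin n))

  sum²-cong : ∀ {f g : Fin n → Fin n → ℕ} → (∀ i j → f i j ≡ g i j) → sum² f ≡ sum² g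
  sum²-cong f≡g = cong sum (map-cong (λ i → cong sum (map-cong (f≡g i) (allFin n))) (allFin n))

  sum²-+ : ∀ (f g : Fin n → Fin n → ℕ) → sum² (λ i j → f i j + g i j) ≡ sum² f + sum² g
  sum²-+ f g = trans (cong sum (map-cong (λ i → sum-+ (f i) (g i) (allFin n)) (allFin n)))
                     (sum-+ _ _ (allFin n))

  sum²-transpose : ∀ (f : Fin n → Fin n → ℕ) → sum² (λ i j → f j i) ≡ sum² f
  sum²-transpose f = sum-transpose (λ i j → f j i) (allFin n) (allFin n)

module _ {n : ℕ} (G : Graph n) where

  edge : Fin n → Fin n → Bool
  edge i j = (toℕ i <ᵇ toℕ j) ∧ adj G i j

  edgeCount : ℕ
  edgeCount = sum² λ i j → 𝟙 (edge i j)

  degreeSum : ℕ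
  degreeSum = sum (map (deg G) (allFin n))

  adj-split : ∀ i j → 𝟙 (adj G i j) ≡ 𝟙 (edge i j) + 𝟙 (edge j i)
  adj-split i j with toℕ i <ᵇ toℕ j | ℕP.<ᵇ-reflects-< (toℕ i) (toℕ j)
                   | toℕ j <ᵇ toℕ i | ℕP.<ᵇ-reflects-< (toℕ j) (toℕ i)
  ... | true  | ofʸ i<j | true  | ofʸ j<i = ⊥-elim (ℕP.<-asym i<j j<i)
  ... | true  | _       | false | _       = sym (ℕP.+-identityʳ _)
  ... | false | _       | true  | _       = cong 𝟙 (Graph.sym G i j)
  ... | false | ofⁿ i≮j | false | ofⁿ j≮i
    rewrite toℕ-injective (ℕP.≤-antisym (ℕP.≮⇒≥ j≮i) (ℕP.≮⇒≥ i≮j)) | irrefl G j = refl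

  handshake : degreeSum ≡ edgeCount + edgeCount
  handshake = begin
    sum² (λ i j → 𝟙 (adj G i j))                 ≡⟨ sum²-cong adj-split ⟩
    sum² (λ i j → 𝟙 (edge i j) + 𝟙 (edge j i))   ≡⟨ sum²-+ (λ i j → 𝟙 (edge i j)) (λ i j → 𝟙 (edge j i)) ⟩
    edgeCount + sum² (λ i j → 𝟙 (edge j i))      ≡⟨ cong (_+_ edgeCount) (sum²-transpose (λ i j → 𝟙 (edge i j))) ⟩
    edgeCount + edgeCount                        ∎
    where open ≡-Reasoning

  deg≤maxDeg : ∀ i → deg G i ℕ.≤ maxDeg G
  deg≤maxDeg i = ∈⇒≤foldr-⊔ (∈-map⁺ (deg G) (∈-allFin i))

  adj⇒1≤deg : ∀ {i j} → adj G i j ≡ true → 1 ℕ.≤ deg G i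
  adj⇒1≤deg {i} {j} ij∈E = subst (λ b → 𝟙 b ℕ.≤ deg G i) ij∈E (∈⇒≤sum (λ j → 𝟙 (adj G i j)) (∈-allFin j))

  isolated-reachable : ∀ {i j} → deg G i ≡ 0 → Reachable G i j → i ≡ j
  isolated-reachable _      here          = refl
  isolated-reachable deg≡0 (step ij∈E _) = ⊥-elim (ℕP.n≮0 (subst (1 ℕ.≤_) deg≡0 (adj⇒1≤deg ij∈E)))

  length-allFin : length (allFin n) ≡ n
  length-allFin = length-tabulate (λ i → i)

  degreeSum≤ : degreeSum ℕ.≤ n * maxDeg G
  degreeSum≤ = subst (λ l → degreeSum ℕ.≤ l * maxDeg G) length-allFin (sum-map-≤ deg≤maxDeg (allFin n))

  degreeSum≡⇒deg≡maxDeg : degreeSum ≡ n * maxDeg G → ∀ i → deg G i ≡ maxDeg G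
  degreeSum≡⇒deg≡maxDeg sum≡ i = sum-map-≡⇒≡ deg≤maxDeg (allFin n)
    (trans sum≡ (cong (_* maxDeg G) (sym length-allFin))) (∈-allFin i)

  deg≡maxDeg⇒degreeSum≡ : (∀ i → deg G i ≡ maxDeg G) → degreeSum ≡ n * maxDeg G
  deg≡maxDeg⇒degreeSum≡ deg≡ = trans (sum-map-const deg≡ (allFin n)) (cong (_* maxDeg G) length-allFin)

  regular⇒deg≡maxDeg : Regular G → ∀ i → deg G i ≡ maxDeg G
  regular⇒deg≡maxDeg (r , deg≡r) i = ℕP.≤-antisym (deg≤maxDeg i)
    (subst (maxDeg G ℕ.≤_) (sym (deg≡r i)) (foldr-⊔-lub (λ j → ℕP.≤-reflexive (deg≡r j)) (allFin n)))

connected-maxDeg≤1⇒regular : ∀ {n} (G : Graph n) → Connected G → maxDeg G ℕ.≤ 1 → Regular G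
connected-maxDeg≤1⇒regular {zero}  G _    _   = 0 , λ ()
connected-maxDeg≤1⇒regular {suc n} G conn Δ≤1 = deg G zero , λ j → same-degree j (deg≤1 j) (deg≤1 zero)
  where
  deg≤1 : ∀ i → deg G i ≡ 0 ⊎ deg G i ≡ 1
  deg≤1 i = ℕP.n≤1⇒n≡0∨n≡1 (ℕP.≤-trans (deg≤maxDeg G i) Δ≤1)
  same-degree : ∀ j → deg G j ≡ 0 ⊎ deg G j ≡ 1 → deg G zero ≡ 0 ⊎ deg G zero ≡ 1 → deg G j ≡ deg G zero
  same-degree j (inj₁ j-isolated) _                = cong (deg G) (isolated-reachable G j-isolated (conn j zero))
  same-degree j _                (inj₁ 0-isolated) = cong (deg G) (sym (isolated-reachable G 0-isolated (conn zero j)))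
  same-degree j (inj₂ dj≡1)      (inj₂ d0≡1)       = trans dj≡1 (sym d0≡1)

module _ {n : ℕ} (G : Graph n) where

  mixedWeight : ℚ
  mixedWeight = isddWeight (maxDeg G) (maxDeg G ∸ 1)

  isddTerm : Fin n → Fin n → ℚ
  isddTerm i j = if edge G i j then isddWeight (deg G i) (deg G j) else 0ℚ

  edgeEstimate : Fin n → Fin n → ℚ
  edgeEstimate i j = if edge G i j then (if deg G i ≡ᵇ deg G j then ½ else mixedWeight) else 0ℚ

  ISDD≤sum-edgeEstimate : ISDD G ≤ sumℚ² edgeEstimate
  ISDD≤sum-edgeEstimate = sumℚ²-mono {f = isddTerm} λ i j → if-≤ (edge G i j) λ ij∈E →
    isddWeight-≤-estimate (adj⇒1≤deg G (∧-conicalʳ _ _ ij∈E)) (deg≤maxDeg G i) (deg≤maxDeg G j)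

  regular⇒ISDD≡sum-edgeEstimate : Regular G → ISDD G ≡ sumℚ² edgeEstimate
  regular⇒ISDD≡sum-edgeEstimate reg = sumℚ²-cong {f = isddTerm} λ i j → if-≡ (edge G i j) λ ij∈E →
    isddWeight-≡-estimate (maxDeg G) (adj⇒1≤deg G (∧-conicalʳ _ _ ij∈E))
      (trans (regular⇒deg≡maxDeg G reg i) (sym (regular⇒deg≡maxDeg G reg j)))

  sameDegreeEdge : Fin n → Fin n → Bool
  sameDegreeEdge i j = edge G i j ∧ (deg G i ≡ᵇ deg G j)

  kEq≡ : kEq G ≡ sum² (λ i j → 𝟙 (sameDegreeEdge i j))
  kEq≡ = sum²-cong λ i j → cong 𝟙 (sym (∧-assoc (toℕ i <ᵇ toℕ j) (adj G i j) (deg G i ≡ᵇ deg G j)))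

  sum-edgeEstimate : sumℚ² edgeEstimate
                   ≡ mixedWeight ℚ.* fromℕ (edgeCount G) ℚ.+ (½ ℚ.- mixedWeight) ℚ.* fromℕ (kEq G)
  sum-edgeEstimate = begin
    sumℚ² edgeEstimate
      ≡⟨ sumℚ²-cong (λ i j → if-indicators (edge G i j) (deg G i ≡ᵇ deg G j) mixedWeight) ⟩
    sumℚ² (λ i j → mixedWeight ℚ.* E i j ℚ.+ (½ ℚ.- mixedWeight) ℚ.* Eₛ i j)
      ≡⟨ sumℚ²-linear mixedWeight (½ ℚ.- mixedWeight) E Eₛ ⟩
    mixedWeight ℚ.* sumℚ² E ℚ.+ (½ ℚ.- mixedWeight) ℚ.* sumℚ² Eₛ
      ≡⟨ cong₂ (λ x y → mixedWeight ℚ.* x ℚ.+ (½ ℚ.- mixedWeight) ℚ.* y)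
               (sumℚ²-fromℕ (λ i j → 𝟙 (edge G i j)))
               (trans (sumℚ²-fromℕ (λ i j → 𝟙 (sameDegreeEdge i j))) (cong fromℕ (sym kEq≡))) ⟩
    mixedWeight ℚ.* fromℕ (edgeCount G) ℚ.+ (½ ℚ.- mixedWeight) ℚ.* fromℕ (kEq G) ∎
    where
    open ≡-Reasoning
    E Eₛ : Fin n → Fin n → ℚ
    E i j = fromℕ (𝟙 (edge G i j))
    Eₛ i j = fromℕ (𝟙 (sameDegreeEdge i j))

  degreeDeficit : ℕ
  degreeDeficit = n * maxDeg G ∸ degreeSum G

  slack : ℚ
  slack = mixedWeight ℚ.* ½ ℚ.* fromℕ degreeDeficit

  bound≡ : bound G ≡ sumℚ² edgeEstimate ℚ.+ slack
  bound≡ = begin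
    bound G
      ≡⟨ cong₂ (λ x y → x ℚ.+ c ℚ.* (y ℚ.- K)) (/2≡½*fromℕ (kEq G))
               (trans (/2≡½*fromℕ (n * maxDeg G)) (cong (½ ℚ.*_) fromℕ-nΔ)) ⟩
    ½ ℚ.* K ℚ.+ c ℚ.* (½ ℚ.* (M ℚ.+ M ℚ.+ D) ℚ.- K)
      ≡⟨ solve 4 (λ c K M D → con ½ :* K :+ c :* (con ½ :* (M :+ M :+ D) :- K)
                              := c :* M :+ (con ½ :- c) :* K :+ c :* con ½ :* D) refl c K M D ⟩
    c ℚ.* M ℚ.+ (½ ℚ.- c) ℚ.* K ℚ.+ slack
      ≡⟨ cong (ℚ._+ slack) (sym sum-edgeEstimate) ⟩
    sumℚ² edgeEstimate ℚ.+ slack ∎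
    where
    open ≡-Reasoning
    open ℚ-Solver
    c = mixedWeight
    K = fromℕ (kEq G)
    M = fromℕ (edgeCount G)
    D = fromℕ degreeDeficit
    fromℕ-nΔ : fromℕ (n * maxDeg G) ≡ M ℚ.+ M ℚ.+ D
    fromℕ-nΔ = begin
      fromℕ (n * maxDeg G)
        ≡⟨ cong fromℕ (sym (ℕP.m+[n∸m]≡n (degreeSum≤ G))) ⟩
      fromℕ (degreeSum G + degreeDeficit)
        ≡⟨ cong (λ s → fromℕ (s + degreeDeficit)) (handshake G) ⟩
      fromℕ (edgeCount G + edgeCount G + degreeDeficit)
        ≡⟨ trans (fromℕ-+ (edgeCount G + edgeCount G) degreeDeficit)
                 (cong (ℚ._+ D) (fromℕ-+ (edgeCount G) (edgeCount G))) ⟩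
      M ℚ.+ M ℚ.+ D ∎

  slack-nonNeg : 0ℚ ≤ slack
  slack-nonNeg = ℚP.nonNegative⁻¹ slack
    {{ℚP.nonNeg*nonNeg⇒nonNeg (mixedWeight ℚ.* ½)
        {{ℚP.nonNeg*nonNeg⇒nonNeg mixedWeight {{isddWeight-nonNeg (maxDeg G) (maxDeg G ∸ 1)}} ½}}
        (fromℕ degreeDeficit) {{fromℕ-nonNeg degreeDeficit}}}}

  slack-pos : 2 ℕ.≤ maxDeg G → 0 ℕ.< degreeDeficit → 0ℚ < slack
  slack-pos 2≤Δ 0<δ = ℚP.positive⁻¹ slack
    {{ℚP.pos*pos⇒pos (mixedWeight ℚ.* ½) {{ℚP.pos*pos⇒pos mixedWeight {{isddWeight-pred-pos 2≤Δ}} ½}}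
                     (fromℕ degreeDeficit) {{fromℕ-pos 0<δ}}}}

  ISDD≤bound : ISDD G ≤ bound G
  ISDD≤bound = begin
    ISDD G                         ≤⟨ ISDD≤sum-edgeEstimate ⟩
    sumℚ² edgeEstimate             ≡⟨ sym (ℚP.+-identityʳ _) ⟩
    sumℚ² edgeEstimate ℚ.+ 0ℚ      ≤⟨ ℚP.+-monoʳ-≤ (sumℚ² edgeEstimate) slack-nonNeg ⟩
    sumℚ² edgeEstimate ℚ.+ slack   ≡⟨ sym bound≡ ⟩
    bound G                        ∎
    where open ℚP.≤-Reasoning

  ISDD<bound : 2 ℕ.≤ maxDeg G → 0 ℕ.< degreeDeficit → ISDD G < bound G
  ISDD<bound 2≤Δ 0<δ = begin-strict
    ISDD G                         ≤⟨ ISDD≤sum-edgeEstimate ⟩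
    sumℚ² edgeEstimate             ≡⟨ sym (ℚP.+-identityʳ _) ⟩
    sumℚ² edgeEstimate ℚ.+ 0ℚ      <⟨ ℚP.+-monoʳ-< (sumℚ² edgeEstimate) (slack-pos 2≤Δ 0<δ) ⟩
    sumℚ² edgeEstimate ℚ.+ slack   ≡⟨ sym bound≡ ⟩
    bound G                        ∎
    where open ℚP.≤-Reasoning

  ISDD≡bound⇒regular : 2 ℕ.≤ maxDeg G → ISDD G ≡ bound G → Regular G
  ISDD≡bound⇒regular 2≤Δ ISDD≡bound = maxDeg G , degreeSum≡⇒deg≡maxDeg G degreeSum≡
    where
    deficit≡0 : degreeDeficit ≡ 0
    deficit≡0 = ℕP.n≤0⇒n≡0 (ℕP.≮⇒≥ λ 0<δ → ℚP.<-irrefl ISDD≡bound (ISDD<bound 2≤Δ 0<δ))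
    degreeSum≡ : degreeSum G ≡ n * maxDeg G
    degreeSum≡ = ℕP.≤-antisym (degreeSum≤ G) (ℕP.m∸n≡0⇒m≤n deficit≡0)

  regular⇒ISDD≡bound : Regular G → ISDD G ≡ bound G
  regular⇒ISDD≡bound reg = begin
    ISDD G                         ≡⟨ regular⇒ISDD≡sum-edgeEstimate reg ⟩
    sumℚ² edgeEstimate             ≡⟨ sym (ℚP.+-identityʳ _) ⟩
    sumℚ² edgeEstimate ℚ.+ 0ℚ      ≡⟨ cong (sumℚ² edgeEstimate ℚ.+_) (sym slack≡0) ⟩
    sumℚ² edgeEstimate ℚ.+ slack   ≡⟨ sym bound≡ ⟩
    bound G                        ∎
    where
    open ≡-Reasoning
    deficit≡0 : degreeDeficit ≡ 0
    deficit≡0 = trans (cong (n * maxDeg G ∸_) (deg≡maxDeg⇒degreeSum≡ G (regular⇒deg≡maxDeg G reg)))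
                      (ℕP.n∸n≡0 (n * maxDeg G))
    slack≡0 : slack ≡ 0ℚ
    slack≡0 = trans (cong (λ δ → mixedWeight ℚ.* ½ ℚ.* fromℕ δ) deficit≡0) (ℚP.*-zeroʳ (mixedWeight ℚ.* ½))

  connected-ISDD≡bound⇒regular : Connected G → ISDD G ≡ bound G → Regular G
  connected-ISDD≡bound⇒regular conn ISDD≡bound with maxDeg G ℕ.≤? 1
  ... | yes Δ≤1 = connected-maxDeg≤1⇒regular G conn Δ≤1
  ... | no  Δ≰1 = ISDD≡bound⇒regular (ℕP.≰⇒> Δ≰1) ISDD≡bound

corollary2p7 : ∀ {n : ℕ} (G : Graph n) →
    (ISDD G ≤ bound G) × (Connected G → ((ISDD G ≡ bound G) ⇔ Regular G))
corollary2p7 G = ISDD≤bound G , λ conn →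
  mk⇔ (connected-ISDD≡bound⇒regular G conn) (regular⇒ISDD≡bound G)
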